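{- Let $\mathcal{C}=(1,c_2,c_3,c_4,c_5,c_6)$ be a coin system with pattern $(+++--+)$. Then $\mathcal{C}$ has one of the following forms: \begin{enumerate} \item $(1,a,2a-1,b,a+b-1,2b-1)$ where $a\geq 3$ and $b>2a-1$; \item $(1,a,2a,b,a+b,2b)$ where $a\geq 2$ and $b>2a$. \end{enumerate}
   Context: A coin system is a tuple $\mathcal{C}=(c_1,c_2,\ldots,c_n)$ of integers with $c_1=1<c_2<\cdots<c_n$; each coin value may be used any number of times. For a positive integer $v$, $opt_{\mathcal{C}}(v)$ is the minimum number of coins (with values in $\mathcal{C}$) summing to $v$, and $grd_{\mathcal{C}}(v)$ is the number of coins used by the greedy algorithm (repeatedly take as many coins as possible of the largest coin value not exceeding the remaining amount). $\mathcal{C}$ is orderly if $grd_{\mathcal{C}}(v)=opt_{\mathcal{C}}(v)$ for all $v>0$. The prefix coin system of length $i$ is $(1,c_2,\ldots,c_i)$. The pattern of $\mathcal{C}$ is the string of $n$ symbols whose $i$-th symbol is $+$ if the prefix coin system of length $i$ is orderly and $-$ otherwise. -}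

module Defs where

open import Data.Nat using (ℕ; zero; suc; _+_; _<_; _/_; _%_)
open import Data.List using (List; []; _∷_; length; reverse; take; lookup)
open import Data.Nat.ListAction using (sum)
open import Data.Empty using (⊥)
open import Data.List.Relation.Unary.All using (All)
open import Data.List.Relation.Unary.Linked using (Linked)
open import Data.List.Membership.Propositional using (_∈_)
open import Data.Fin using (Fin; toℕ)
open import Data.Product using (Σ; _×_; ∃)
open import Relation.Binary.PropositionalEquality using (_≡_)
open import Relation.Nullary using (¬_)

CoinSystem : List ℕ → Set
CoinSystem []      = ⊥
CoinSystem (c ∷ cs) = c ≡ 1 × Linked _<_ (c ∷ cs)

Rep : List ℕ → ℕ → List ℕ → Set
Rep C v xs = All (_∈ C) xs × sum xs ≡ v

IsOpt : List ℕ → ℕ → ℕ → Set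
IsOpt C v k = (Σ (List ℕ) λ xs → Rep C v xs × length xs ≡ k)
            × (∀ xs → Rep C v xs → k Data.Nat.≤ length xs)

grdDesc : List ℕ → ℕ → ℕ
grdDesc []            v = 0
grdDesc (zero ∷ cs)   v = grdDesc cs v
grdDesc (suc c ∷ cs)  v = v / suc c + grdDesc cs (v % suc c)

grd : List ℕ → ℕ → ℕ
grd C v = grdDesc (reverse C) v

Orderly : List ℕ → Set
Orderly C = ∀ v → 0 < v → IsOpt C v (grd C v)

data Sign : Set where
  plus minus : Sign

SignHolds : Sign → List ℕ → Set
SignHolds plus  C = Orderly C
SignHolds minus C = ¬ Orderly C

-- The pattern of C is p: p has length n and its i-th symbol (0-based i)
-- is + iff the prefix system of length i+1 is orderly.
HasPattern : List ℕ → List Sign → Set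
HasPattern C p = length p ≡ length C
               × (∀ (i : Fin (length p)) → SignHolds (lookup p i) (take (suc (toℕ i)) C))

-- Write the system as (1, a, c, b, d, e). Since (1, a, c) is orderly but (1, a, c, b) is not, the
-- one-point theorem says that greedy on (1, a, c) pays b + x = k c with at least k coins; hence
-- b + x is never a multiple of c for x ∈ {0, 1, a}, and for b + δ = m c with δ < c the coin d lies
-- below b + δ. Orderliness of the whole system lets greedy pay every sum of two coins with at most
-- two coins, so after its largest coin the remainder is 0 or a coin. Reading off these remainders
-- for b + c, 2b, b + d and, where needed, c + d, a + d and 2d gives linear equations among the
-- coins, which leave exactly the two families; the single other survivor, (1, 2, c, c + 1, 2c), is
-- orderly and so excluded by the minus sign of the prefix of length five.

module Submission where

open import Defs
open import Data.Nat using (ℕ; _+_; _*_; _∸_; _≤_; _<_)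
open import Data.List using (List; []; _∷_)
open import Data.Product using (Σ; _×_; _,_)
open import Data.Sum using (_⊎_)
open import Relation.Binary.PropositionalEquality using (_≡_)

open import Data.Nat using (zero; suc; s≤s; z≤n; z<s; _>_; _⊔_; _/_; _%_; _<?_; _≤?_; _≡ᵇ_; _<ᵇ_; _≤ᵇ_)
open import Data.Nat.Properties
open import Data.Nat.DivMod
open import Data.Nat.Induction using (<-rec)
open import Data.List using (_++_; _∷ʳ_; length; reverse; replicate; map; foldr; concatMap; filterᵇ; upTo)
open import Data.Bool.ListAction using (any)
open import Data.Bool using (Bool; true; false; T; _∧_)
open import Data.Bool.Properties using (T-∧)
open import Function.Bundles using (Equivalence)
open import Algebra.Properties.CommutativeSemigroup +-commutativeSemigroup using (interchange)
open import Data.List.Properties using (length-++; length-replicate; unfold-reverse; reverse-++)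
open import Data.Nat.ListAction using (sum)
open import Data.Nat.ListAction.Properties using (sum-++)
open import Data.List.Relation.Unary.All as All using (All; []; _∷_)
open import Data.List.Relation.Unary.Linked as Linked using (Linked; [-]; _∷_)
open import Data.List.Relation.Unary.Linked.Properties using (Linked⇒All)
import Data.List.Relation.Unary.All.Properties as AllP
open import Data.List.Relation.Unary.Any using (here; there)
import Data.List.Relation.Unary.Any.Properties as AnyP
open import Data.List.Membership.Propositional using (_∈_)
open import Data.Product using (proj₂)
open import Data.Sum as Sum using (inj₁; inj₂)
open import Data.Empty using (⊥; ⊥-elim)
open import Relation.Binary.PropositionalEquality using (refl; sym; trans; cong; cong₂; subst; subst₂; module ≡-Reasoning)
open import Relation.Nullary using (yes; no)
open import Function using (case_of_)
open import Data.Fin using (#_)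
open import Relation.Binary.Definitions using (tri<; tri≈; tri>)
open import Data.Nat.Tactic.RingSolver using (solve-∀)

-- Linear arithmetic over ℕ by Fourier–Motzkin elimination

module Linarith where

  infixl 6 _⊕_
  infixl 7 _⊛_

  data Expr : Set where
    var : ℕ → Expr
    con : ℕ → Expr
    _⊕_ : Expr → Expr → Expr
    _⊛_ : ℕ → Expr → Expr

  Env : Set
  Env = List ℕ

  -- Variables missing from the environment read as 0.
  head₀ : Env → ℕ
  head₀ []      = 0
  head₀ (x ∷ _) = x

  tail₀ : Env → Env
  tail₀ []       = []
  tail₀ (_ ∷ xs) = xs

  lookup₀ : Env → ℕ → ℕ
  lookup₀ ρ zero    = head₀ ρ
  lookup₀ ρ (suc i) = lookup₀ (tail₀ ρ) i

  ⟦_⟧ : Expr → Env → ℕ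
  ⟦ var i ⟧ ρ = lookup₀ ρ i
  ⟦ con n ⟧ ρ = n
  ⟦ x ⊕ y ⟧ ρ = ⟦ x ⟧ ρ + ⟦ y ⟧ ρ
  ⟦ n ⊛ x ⟧ ρ = n * ⟦ x ⟧ ρ

  record Linear : Set where
    constructor linear
    field
      const  : ℕ
      coeffs : List ℕ
  open Linear

  evalᶜ : List ℕ → Env → ℕ
  evalᶜ []       ρ = 0
  evalᶜ (k ∷ ks) ρ = k * head₀ ρ + evalᶜ ks (tail₀ ρ)

  evalˡ : Linear → Env → ℕ
  evalˡ (linear k ks) ρ = k + evalᶜ ks ρ

  addᶜ : List ℕ → List ℕ → List ℕ
  addᶜ []       ys       = ys
  addᶜ (x ∷ xs) []       = x ∷ xs
  addᶜ (x ∷ xs) (y ∷ ys) = x + y ∷ addᶜ xs ys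

  scaleᶜ : ℕ → List ℕ → List ℕ
  scaleᶜ n = map (n *_)

  unitᶜ : ℕ → List ℕ
  unitᶜ zero    = 1 ∷ []
  unitᶜ (suc i) = 0 ∷ unitᶜ i

  _+ˡ_ : Linear → Linear → Linear
  linear k ks +ˡ linear j js = linear (k + j) (addᶜ ks js)

  _*ˡ_ : ℕ → Linear → Linear
  n *ˡ linear k ks = linear (n * k) (scaleᶜ n ks)

  normalise : Expr → Linear
  normalise (var i) = linear 0 (unitᶜ i)
  normalise (con n) = linear n []
  normalise (x ⊕ y) = normalise x +ˡ normalise y
  normalise (n ⊛ x) = n *ˡ normalise x

  evalᶜ-addᶜ : ∀ xs ys ρ → evalᶜ (addᶜ xs ys) ρ ≡ evalᶜ xs ρ + evalᶜ ys ρ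
  evalᶜ-addᶜ []       ys       ρ = refl
  evalᶜ-addᶜ (x ∷ xs) []       ρ = sym (+-identityʳ _)
  evalᶜ-addᶜ (x ∷ xs) (y ∷ ys) ρ
    rewrite evalᶜ-addᶜ xs ys (tail₀ ρ) | *-distribʳ-+ (head₀ ρ) x y
    = interchange (x * head₀ ρ) (y * head₀ ρ) (evalᶜ xs (tail₀ ρ)) (evalᶜ ys (tail₀ ρ))

  evalᶜ-scaleᶜ : ∀ n xs ρ → evalᶜ (scaleᶜ n xs) ρ ≡ n * evalᶜ xs ρ
  evalᶜ-scaleᶜ n []       ρ = sym (*-zeroʳ n)
  evalᶜ-scaleᶜ n (x ∷ xs) ρ
    rewrite evalᶜ-scaleᶜ n xs (tail₀ ρ) | *-assoc n x (head₀ ρ)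
    = sym (*-distribˡ-+ n (x * head₀ ρ) _)

  evalᶜ-unitᶜ : ∀ i ρ → evalᶜ (unitᶜ i) ρ ≡ lookup₀ ρ i
  evalᶜ-unitᶜ zero    ρ = trans (+-identityʳ _) (+-identityʳ (head₀ ρ))
  evalᶜ-unitᶜ (suc i) ρ = evalᶜ-unitᶜ i (tail₀ ρ)

  evalˡ-+ˡ : ∀ p q ρ → evalˡ (p +ˡ q) ρ ≡ evalˡ p ρ + evalˡ q ρ
  evalˡ-+ˡ (linear k ks) (linear j js) ρ
    rewrite evalᶜ-addᶜ ks js ρ = interchange k j (evalᶜ ks ρ) (evalᶜ js ρ)

  evalˡ-*ˡ : ∀ n p ρ → evalˡ (n *ˡ p) ρ ≡ n * evalˡ p ρ
  evalˡ-*ˡ n (linear k ks) ρ rewrite evalᶜ-scaleᶜ n ks ρ = sym (*-distribˡ-+ n k _)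

  normalise-sound : ∀ e ρ → evalˡ (normalise e) ρ ≡ ⟦ e ⟧ ρ
  normalise-sound (var i) ρ = evalᶜ-unitᶜ i ρ
  normalise-sound (con n) ρ = +-identityʳ n
  normalise-sound (x ⊕ y) ρ
    rewrite evalˡ-+ˡ (normalise x) (normalise y) ρ
          | normalise-sound x ρ | normalise-sound y ρ = refl
  normalise-sound (n ⊛ x) ρ
    rewrite evalˡ-*ˡ n (normalise x) ρ | normalise-sound x ρ = refl

  -- Derived inequalities carry their proofs, so the search below needs no soundness argument.
  record Ineq (ρ : Env) : Set where
    constructor ineq
    field
      lhs rhs : Linear
      holds   : evalˡ lhs ρ ≤ evalˡ rhs ρ
  open Ineq

  data Hyp (ρ : Env) : Set where
    le : (l r : Expr) → ⟦ l ⟧ ρ ≤ ⟦ r ⟧ ρ → Hyp ρ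
    lt : (l r : Expr) → ⟦ l ⟧ ρ < ⟦ r ⟧ ρ → Hyp ρ
    eq : (l r : Expr) → ⟦ l ⟧ ρ ≡ ⟦ r ⟧ ρ → Hyp ρ

  module _ {ρ : Env} where

    infixl 6 _⊞_
    infixl 7 _⊠_

    fromLe : (l r : Expr) → ⟦ l ⟧ ρ ≤ ⟦ r ⟧ ρ → Ineq ρ
    fromLe l r p = ineq (normalise l) (normalise r)
      (subst₂ _≤_ (sym (normalise-sound l ρ)) (sym (normalise-sound r ρ)) p)

    ineqs : Hyp ρ → List (Ineq ρ)
    ineqs (le l r p) = fromLe l r p ∷ []
    ineqs (lt l r p) = fromLe (con 1 ⊕ l) r p ∷ []
    ineqs (eq l r p) = fromLe l r (≤-reflexive p) ∷ fromLe r l (≤-reflexive (sym p)) ∷ []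

    _⊞_ : Ineq ρ → Ineq ρ → Ineq ρ
    ineq l r p ⊞ ineq l′ r′ p′ = ineq (l +ˡ l′) (r +ˡ r′)
      (subst₂ _≤_ (sym (evalˡ-+ˡ l l′ ρ)) (sym (evalˡ-+ˡ r r′ ρ)) (+-mono-≤ p p′))

    _⊠_ : ℕ → Ineq ρ → Ineq ρ
    n ⊠ ineq l r p = ineq (n *ˡ l) (n *ˡ r)
      (subst₂ _≤_ (sym (evalˡ-*ˡ n l ρ)) (sym (evalˡ-*ˡ n r ρ)) (*-monoʳ-≤ n p))

    coeff : ℕ → List ℕ → ℕ
    coeff _       []       = 0
    coeff zero    (k ∷ _)  = k
    coeff (suc i) (_ ∷ ks) = coeff i ks

    surplus deficit : ℕ → Ineq ρ → ℕ
    surplus i f = coeff i (coeffs (rhs f)) ∸ coeff i (coeffs (lhs f))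
    deficit i f = coeff i (coeffs (lhs f)) ∸ coeff i (coeffs (rhs f))

    -- Fourier–Motzkin for nonnegative variables: an inequality with surplus in variable i is only
    -- useful once that surplus is cancelled against the deficit of another one.
    eliminate : ℕ → List (Ineq ρ) → List (Ineq ρ)
    eliminate i fs = kept ++ concatMap (λ p → map (λ n → deficit i n ⊠ p ⊞ surplus i p ⊠ n) lower) upper
      where
      kept  = filterᵇ (λ f → surplus i f ≡ᵇ 0) fs
      upper = filterᵇ (λ f → 0 <ᵇ surplus i f) fs
      lower = filterᵇ (λ f → 0 <ᵇ deficit i f) kept

    dominatesᶜ : List ℕ → List ℕ → Bool
    dominatesᶜ xs       []       = true
    dominatesᶜ []       (y ∷ ys) = (y ≡ᵇ 0) ∧ dominatesᶜ [] ys
    dominatesᶜ (x ∷ xs) (y ∷ ys) = (y ≤ᵇ x) ∧ dominatesᶜ xs ys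

    absurd? : Ineq ρ → Bool
    absurd? f = (suc (const (rhs f)) ≤ᵇ const (lhs f)) ∧ dominatesᶜ (coeffs (lhs f)) (coeffs (rhs f))

    width : List (Ineq ρ) → ℕ
    width = foldr (λ f w → length (coeffs (lhs f)) ⊔ length (coeffs (rhs f)) ⊔ w) 0

    fourierMotzkin : List (Ineq ρ) → List (Ineq ρ)
    fourierMotzkin fs = foldr eliminate fs (upTo (width fs))

    Refutable : List (Hyp ρ) → Set
    Refutable hs = T (any absurd? (fourierMotzkin (concatMap ineqs hs)))

    dominatesᶜ-sound : ∀ xs ys σ → T (dominatesᶜ xs ys) → evalᶜ ys σ ≤ evalᶜ xs σ
    dominatesᶜ-sound xs       []       σ _ = z≤n
    dominatesᶜ-sound []       (y ∷ ys) σ t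
      with y≡0 , rest ← Equivalence.to T-∧ t rewrite ≡ᵇ⇒≡ y 0 y≡0 = dominatesᶜ-sound [] ys (tail₀ σ) rest
    dominatesᶜ-sound (x ∷ xs) (y ∷ ys) σ t with y≤x , rest ← Equivalence.to T-∧ t =
      +-mono-≤ (*-monoˡ-≤ (head₀ σ) (≤ᵇ⇒≤ y x y≤x)) (dominatesᶜ-sound xs ys (tail₀ σ) rest)

    absurd-sound : (f : Ineq ρ) → T (absurd? f) → ⊥
    absurd-sound (ineq (linear k ks) (linear j js) p) t with j<k , js≤ks ← Equivalence.to T-∧ t =
      <-irrefl refl (≤-trans (+-mono-≤ (≤ᵇ⇒≤ (suc j) k j<k) (dominatesᶜ-sound ks js ρ js≤ks)) p)

    any-absurd-sound : (fs : List (Ineq ρ)) → T (any absurd? fs) → ⊥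
    any-absurd-sound (f ∷ fs) t with absurd? f in absurd
    ... | true  = absurd-sound f (subst T (sym absurd) _)
    ... | false = any-absurd-sound fs t

  linarith : ∀ {ρ} (hs : List (Hyp ρ)) → {Refutable hs} → ⊥
  linarith hs {t} = any-absurd-sound (fourierMotzkin (concatMap ineqs hs)) t

  linarith-≤ : ∀ {ρ} (l r : Expr) (hs : List (Hyp ρ)) →
    {∀ p → Refutable (lt r l p ∷ hs)} → ⟦ l ⟧ ρ ≤ ⟦ r ⟧ ρ
  linarith-≤ l r hs {t} = ≮⇒≥ (λ p → linarith (lt r l p ∷ hs) {t p})

open Linarith

-- Greedy change-making

grdDesc-skip : ∀ {x} cs {v} → v < x → grdDesc (x ∷ cs) v ≡ grdDesc cs v
grdDesc-skip {suc x} cs v<x = cong₂ _+_ (m<n⇒m/n≡0 v<x) (cong (grdDesc cs) (m<n⇒m%n≡m v<x))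

grdDesc-skipAll : ∀ pre cs {v} → All (v <_) pre → grdDesc (pre ++ cs) v ≡ grdDesc cs v
grdDesc-skipAll []        cs []           = refl
grdDesc-skipAll (x ∷ pre) cs (v<x ∷ v<pre) =
  trans (grdDesc-skip (pre ++ cs) v<x) (grdDesc-skipAll pre cs v<pre)

grdDesc-step : ∀ {x} cs r → 0 < x → grdDesc (x ∷ cs) (x + r) ≡ suc (grdDesc (x ∷ cs) r)
grdDesc-step {x@(suc _)} cs r _ = cong₂ _+_ quotient (cong (grdDesc cs) remainder)
  where
  quotient : (x + r) / x ≡ suc (r / x)
  quotient = trans (m/n≡1+[m∸n]/n (m≤m+n x r)) (cong (λ z → suc (z / x)) (m+n∸m≡n x r))
  remainder : (x + r) % x ≡ r % x
  remainder = trans (cong (_% x) (+-comm x r)) ([m+n]%n≡m%n r x)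

grdDesc-take : ∀ {x} cs {r} → r < x → grdDesc (x ∷ cs) (x + r) ≡ suc (grdDesc cs r)
grdDesc-take cs {r} r<x =
  trans (grdDesc-step cs r (≤-<-trans z≤n r<x)) (cong suc (grdDesc-skip cs r<x))

grdDesc-multiple : ∀ {x} cs k r → 0 < x → grdDesc (x ∷ cs) (k * x + r) ≡ k + grdDesc (x ∷ cs) r
grdDesc-multiple     cs zero    r _   = refl
grdDesc-multiple {x} cs (suc k) r x>0 = begin
  grdDesc (x ∷ cs) (x + k * x + r)     ≡⟨ cong (grdDesc (x ∷ cs)) (+-assoc x (k * x) r) ⟩
  grdDesc (x ∷ cs) (x + (k * x + r))   ≡⟨ grdDesc-step cs (k * x + r) x>0 ⟩
  suc (grdDesc (x ∷ cs) (k * x + r))   ≡⟨ cong suc (grdDesc-multiple cs k r x>0) ⟩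
  suc k + grdDesc (x ∷ cs) r           ∎
  where open ≡-Reasoning

grdDesc-zero : ∀ D → grdDesc D 0 ≡ 0
grdDesc-zero []          = refl
grdDesc-zero (zero ∷ D)  = grdDesc-zero D
grdDesc-zero (suc _ ∷ D) = grdDesc-zero D

grdDesc-top : ∀ pre {t} D {r} → All (t + r <_) pre → r < t →
  grdDesc (pre ++ t ∷ D) (t + r) ≡ suc (grdDesc (pre ++ t ∷ D) r)
grdDesc-top pre {t} D {r} t+r<pre r<t = begin
  grdDesc (pre ++ t ∷ D) (t + r)   ≡⟨ grdDesc-skipAll pre (t ∷ D) t+r<pre ⟩
  grdDesc (t ∷ D) (t + r)          ≡⟨ grdDesc-take D r<t ⟩
  suc (grdDesc D r)                ≡⟨ cong suc (grdDesc-skip D r<t) ⟨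
  suc (grdDesc (t ∷ D) r)          ≡⟨ cong suc (grdDesc-skipAll pre (t ∷ D) r<pre) ⟨
  suc (grdDesc (pre ++ t ∷ D) r)   ∎
  where
  open ≡-Reasoning
  r<pre : All (r <_) pre
  r<pre = All.map (≤-<-trans (m≤n+m r t)) t+r<pre

greedyCoins : List ℕ → ℕ → List ℕ
greedyCoins []           v = []
greedyCoins (zero ∷ D)   v = greedyCoins D v
greedyCoins (suc x ∷ D)  v = replicate (v / suc x) (suc x) ++ greedyCoins D (v % suc x)

leftover : List ℕ → ℕ → ℕ
leftover []          v = v
leftover (zero ∷ D)  v = leftover D v
leftover (suc x ∷ D) v = leftover D (v % suc x)

sum-replicate : ∀ k x → sum (replicate k x) ≡ k * x
sum-replicate zero    x = refl
sum-replicate (suc k) x = cong (x +_) (sum-replicate k x)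

length-greedyCoins : ∀ D v → length (greedyCoins D v) ≡ grdDesc D v
length-greedyCoins []          v = refl
length-greedyCoins (zero ∷ D)  v = length-greedyCoins D v
length-greedyCoins (suc x ∷ D) v = begin
  length (replicate (v / suc x) (suc x) ++ greedyCoins D (v % suc x))
    ≡⟨ length-++ (replicate (v / suc x) (suc x)) ⟩
  length (replicate (v / suc x) (suc x)) + length (greedyCoins D (v % suc x))
    ≡⟨ cong₂ _+_ (length-replicate (v / suc x)) (length-greedyCoins D (v % suc x)) ⟩
  v / suc x + grdDesc D (v % suc x) ∎
  where open ≡-Reasoning

sum-greedyCoins : ∀ D v → sum (greedyCoins D v) + leftover D v ≡ v
sum-greedyCoins []          v = refl
sum-greedyCoins (zero ∷ D)  v = sum-greedyCoins D v
sum-greedyCoins (suc x ∷ D) v = begin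
  sum (qs ++ greedyCoins D r) + leftover D r
    ≡⟨ cong (_+ leftover D r) (sum-++ qs (greedyCoins D r)) ⟩
  sum qs + sum (greedyCoins D r) + leftover D r
    ≡⟨ +-assoc (sum qs) _ _ ⟩
  sum qs + (sum (greedyCoins D r) + leftover D r)
    ≡⟨ cong₂ _+_ (sum-replicate (v / suc x) (suc x)) (sum-greedyCoins D r) ⟩
  v / suc x * suc x + r
    ≡⟨ +-comm (v / suc x * suc x) r ⟩
  r + v / suc x * suc x
    ≡⟨ m≡m%n+[m/n]*n v (suc x) ⟨
  v ∎
  where
  open ≡-Reasoning
  qs = replicate (v / suc x) (suc x)
  r  = v % suc x

greedyCoins-∈ : ∀ D v → All (_∈ D) (greedyCoins D v)
greedyCoins-∈ []          v = []
greedyCoins-∈ (zero ∷ D)  v = All.map there (greedyCoins-∈ D v)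
greedyCoins-∈ (suc x ∷ D) v = AllP.++⁺ (AllP.replicate⁺ (v / suc x) (here refl))
                                       (All.map there (greedyCoins-∈ D (v % suc x)))

leftover-∷ʳ1 : ∀ D v → leftover (D ∷ʳ 1) v ≡ 0
leftover-∷ʳ1 []          v = n%1≡0 v
leftover-∷ʳ1 (zero ∷ D)  v = leftover-∷ʳ1 D v
leftover-∷ʳ1 (suc x ∷ D) v = leftover-∷ʳ1 D (v % suc x)

greedy-rep : ∀ cs v → Σ (List ℕ) λ xs → Rep (1 ∷ cs) v xs × length xs ≡ grd (1 ∷ cs) v
greedy-rep cs v = greedyCoins D v , (coins , total) , length-greedyCoins D v
  where
  D = reverse (1 ∷ cs)
  coins : All (_∈ 1 ∷ cs) (greedyCoins D v)
  coins = All.map AnyP.reverse⁻ (greedyCoins-∈ D v)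
  total : sum (greedyCoins D v) ≡ v
  total = begin
    sum (greedyCoins D v)                   ≡⟨ +-identityʳ _ ⟨
    sum (greedyCoins D v) + 0               ≡⟨ cong (sum (greedyCoins D v) +_) (leftover-∷ʳ1 (reverse cs) v) ⟨
    sum (greedyCoins D v) + leftover (reverse cs ∷ʳ 1) v
                                            ≡⟨ cong (λ E → sum (greedyCoins D v) + leftover E v) (unfold-reverse 1 cs) ⟨
    sum (greedyCoins D v) + leftover D v    ≡⟨ sum-greedyCoins D v ⟩
    v ∎
    where open ≡-Reasoning

GreedyOptimal : List ℕ → Set
GreedyOptimal C = ∀ v xs → Rep C v xs → grd C v ≤ length xs

greedyOptimal⇒orderly : ∀ cs → GreedyOptimal (1 ∷ cs) → Orderly (1 ∷ cs)
greedyOptimal⇒orderly cs opt v _ = greedy-rep cs v , opt v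

orderly⇒greedyOptimal : ∀ C → Orderly C → GreedyOptimal C
orderly⇒greedyOptimal C o zero    xs _   rewrite grdDesc-zero (reverse C) = z≤n
orderly⇒greedyOptimal C o (suc v) xs rep = proj₂ (o (suc v) z<s) xs rep

grd-subadditive : ∀ cs → GreedyOptimal (1 ∷ cs) → ∀ u w →
  grd (1 ∷ cs) (u + w) ≤ grd (1 ∷ cs) u + grd (1 ∷ cs) w
grd-subadditive cs opt u w
  with greedy-rep cs u | greedy-rep cs w
... | xs , (xs∈ , Σxs) , |xs| | ys , (ys∈ , Σys) , |ys| =
  subst (grd (1 ∷ cs) (u + w) ≤_) (trans (length-++ xs) (cong₂ _+_ |xs| |ys|))
    (opt (u + w) (xs ++ ys) (AllP.++⁺ xs∈ ys∈ , trans (sum-++ xs ys) (cong₂ _+_ Σxs Σys)))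

greedyOptimal-by-steps : ∀ C → (∀ {y} → y ∈ C → ∀ s → grd C (y + s) ≤ suc (grd C s)) →
  GreedyOptimal C
greedyOptimal-by-steps C step v xs (xs∈ , refl) = go xs xs∈
  where
  go : ∀ xs → All (_∈ C) xs → grd C (sum xs) ≤ length xs
  go []       []         = ≤-reflexive (grdDesc-zero (reverse C))
  go (y ∷ xs) (y∈ ∷ xs∈) = ≤-trans (step y∈ (sum xs)) (s≤s (go xs xs∈))

grdDesc≡0 : ∀ D v → grdDesc (D ∷ʳ 1) v ≡ 0 → v ≡ 0
grdDesc≡0 []          v g≡0 = trans (sym (n/1≡n v)) (trans (sym (+-identityʳ (v / 1))) g≡0)
grdDesc≡0 (zero ∷ D)  v g≡0 = grdDesc≡0 D v g≡0
grdDesc≡0 (suc x ∷ D) v g≡0 = begin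
  v                        ≡⟨ m≡m%n+[m/n]*n v (suc x) ⟩
  v % suc x + v / suc x * suc x
    ≡⟨ cong₂ (λ p q → p + q * suc x) (grdDesc≡0 D (v % suc x) (m+n≡0⇒n≡0 (v / suc x) g≡0))
                                     (m+n≡0⇒m≡0 (v / suc x) g≡0) ⟩
  0                        ∎
  where open ≡-Reasoning

grdDesc≤1 : ∀ D v → grdDesc (D ∷ʳ 1) v ≤ 1 → v ≡ 0 ⊎ v ∈ D ∷ʳ 1
grdDesc≤1 []          v g≤1 = zero-or-one v (subst (_≤ 1) (trans (+-identityʳ (v / 1)) (n/1≡n v)) g≤1)
  where
  zero-or-one : ∀ v → v ≤ 1 → v ≡ 0 ⊎ v ∈ 1 ∷ []
  zero-or-one zero          _           = inj₁ refl
  zero-or-one (suc zero)    _           = inj₂ (here refl)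
  zero-or-one (suc (suc v)) (s≤s ())
grdDesc≤1 (zero ∷ D)  v             g≤1      = Sum.map₂ there (grdDesc≤1 D v g≤1)
grdDesc≤1 (suc x ∷ D) v             g≤1 with v <? suc x
... | yes v<x = Sum.map₂ there (grdDesc≤1 D v (subst (_≤ 1) (grdDesc-skip (D ∷ʳ 1) v<x) g≤1))
... | no  v≮x = inj₂ (here (begin
  v                               ≡⟨ m≡m%n+[m/n]*n v (suc x) ⟩
  v % suc x + v / suc x * suc x   ≡⟨ cong₂ (λ p q → p + q * suc x) remainder≡0 quotient≡1 ⟩
  suc x + 0                       ≡⟨ +-identityʳ (suc x) ⟩
  suc x                           ∎))
  where
  open ≡-Reasoning
  quotient>0 : v / suc x > 0
  quotient>0 = m≥n⇒m/n>0 (≮⇒≥ v≮x)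
  quotient≡1 : v / suc x ≡ 1
  quotient≡1 = ≤-antisym (≤-trans (m≤m+n (v / suc x) _) g≤1) quotient>0
  remainder≡0 : v % suc x ≡ 0
  remainder≡0 = grdDesc≡0 D (v % suc x)
    (n≤0⇒n≡0 (+-cancelˡ-≤ 1 _ _ (≤-trans (+-monoˡ-≤ _ quotient>0) g≤1)))

grd≤1 : ∀ cs v → grd (1 ∷ cs) v ≤ 1 → v ≡ 0 ⊎ v ∈ 1 ∷ cs
grd≤1 cs v g≤1 with grdDesc≤1 (reverse cs) v (subst (λ D → grdDesc D v ≤ 1) (unfold-reverse 1 cs) g≤1)
... | inj₁ v≡0 = inj₁ v≡0
... | inj₂ v∈  = inj₂ (AnyP.reverse⁻ (subst (v ∈_) (sym (unfold-reverse 1 cs)) v∈))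

-- The one-point theorem

module OnePoint (cs D : List ℕ) {c : ℕ} (top : reverse (1 ∷ cs) ≡ c ∷ D) (c>0 : 0 < c)
  (opt : GreedyOptimal (1 ∷ cs)) {b m δ : ℕ} (c<b : c < b)
  (b+δ≡m*c : b + δ ≡ m * c) (cheap : suc (grd (1 ∷ cs) δ) ≤ m) where

  G G⁺ : ℕ → ℕ
  G  = grd (1 ∷ cs)
  G⁺ = grd ((1 ∷ cs) ∷ʳ b)

  G⁺-unfold : ∀ v → G⁺ v ≡ grdDesc (b ∷ reverse (1 ∷ cs)) v
  G⁺-unfold v = cong (λ E → grdDesc E v) (reverse-++ (1 ∷ cs) (b ∷ []))

  G-multiple : ∀ r → G (m * c + r) ≡ m + G r
  G-multiple r = subst (λ E → grdDesc E (m * c + r) ≡ m + grdDesc E r) (sym top)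
                       (grdDesc-multiple D m r c>0)

  -- b + r + δ = m c + r: subadditivity charges b + r at least one coin more than r.
  G-b+ : ∀ r → suc (G r) ≤ G (b + r)
  G-b+ r = +-cancelʳ-≤ (G δ) _ _ (begin
    suc (G r) + G δ    ≡⟨ +-comm (suc (G r)) (G δ) ⟩
    G δ + suc (G r)    ≡⟨ +-suc (G δ) (G r) ⟩
    suc (G δ) + G r    ≤⟨ +-monoˡ-≤ (G r) cheap ⟩
    m + G r            ≡⟨ G-multiple r ⟨
    G (m * c + r)      ≡⟨ cong G shift ⟨
    G (b + r + δ)      ≤⟨ grd-subadditive cs opt (b + r) δ ⟩
    G (b + r) + G δ    ∎)
    where
    open ≤-Reasoning
    shift : b + r + δ ≡ m * c + r
    shift = trans (+-assoc b r δ) (trans (cong (b +_) (+-comm r δ))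
                  (trans (sym (+-assoc b δ r)) (cong (_+ r) b+δ≡m*c)))

  G⁺≤G : ∀ w → G⁺ w ≤ G w
  G⁺≤G = <-rec (λ w → G⁺ w ≤ G w) step
    where
    b>0 : 0 < b
    b>0 = <-trans c>0 c<b
    step : ∀ w → (∀ {u} → u < w → G⁺ u ≤ G u) → G⁺ w ≤ G w
    step w ih with w <? b
    ... | yes w<b = ≤-reflexive (trans (G⁺-unfold w) (grdDesc-skip (reverse (1 ∷ cs)) w<b))
    ... | no  w≮b with m≤n⇒∃[o]m+o≡n (≮⇒≥ w≮b)
    ... | r , refl = begin
      G⁺ (b + r)                                   ≡⟨ G⁺-unfold (b + r) ⟩
      grdDesc (b ∷ reverse (1 ∷ cs)) (b + r)       ≡⟨ grdDesc-step (reverse (1 ∷ cs)) r b>0 ⟩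
      suc (grdDesc (b ∷ reverse (1 ∷ cs)) r)       ≡⟨ cong suc (G⁺-unfold r) ⟨
      suc (G⁺ r)                                   ≤⟨ s≤s (ih (m<n+m r b>0)) ⟩
      suc (G r)                                    ≤⟨ G-b+ r ⟩
      G (b + r)                                    ∎
      where open ≤-Reasoning

  -- Coins of the old system are collected in zs, whose greedy cost is controlled by opt.
  optimal-split : ∀ xs zs → All (_∈ (1 ∷ cs) ∷ʳ b) xs → All (_∈ 1 ∷ cs) zs →
    G⁺ (sum xs + sum zs) ≤ length xs + length zs
  optimal-split [] zs [] zs∈ = ≤-trans (G⁺≤G (sum zs)) (opt (sum zs) zs (zs∈ , refl))
  optimal-split (y ∷ xs) zs (y∈ ∷ xs∈) zs∈ with AnyP.++⁻ (1 ∷ cs) y∈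
  ... | inj₁ y∈C = subst₂ _≤_ (cong G⁺ (+-comm-middle y (sum xs) (sum zs))) (+-suc (length xs) (length zs))
                     (optimal-split xs (y ∷ zs) xs∈ (y∈C ∷ zs∈))
    where
    +-comm-middle : ∀ p q r → q + (p + r) ≡ p + q + r
    +-comm-middle p q r = trans (sym (+-assoc q p r)) (cong (_+ r) (+-comm q p))
  ... | inj₂ (here refl) = begin
    G⁺ (b + sum xs + sum zs)                                ≡⟨ cong G⁺ (+-assoc b (sum xs) (sum zs)) ⟩
    G⁺ (b + (sum xs + sum zs))                              ≡⟨ G⁺-unfold _ ⟩
    grdDesc (b ∷ reverse (1 ∷ cs)) (b + (sum xs + sum zs))  ≡⟨ grdDesc-step _ _ (<-trans c>0 c<b) ⟩
    suc (grdDesc (b ∷ reverse (1 ∷ cs)) (sum xs + sum zs))  ≡⟨ cong suc (G⁺-unfold _) ⟨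
    suc (G⁺ (sum xs + sum zs))                              ≤⟨ s≤s (optimal-split xs zs xs∈ zs∈) ⟩
    suc (length xs + length zs)                             ∎
    where open ≤-Reasoning

  orderly : Orderly ((1 ∷ cs) ∷ʳ b)
  orderly = greedyOptimal⇒orderly (cs ∷ʳ b) λ v xs (xs∈ , Σxs≡v) →
    subst₂ (λ u k → G⁺ u ≤ k) (trans (+-identityʳ (sum xs)) Σxs≡v) (+-identityʳ (length xs))
      (optimal-split xs [] xs∈ [])

-- The orderly system (1, 2, c, c + 1, 2c)

module FSystem (c : ℕ) (c>2 : 2 < c) where

  F : List ℕ
  F = 1 ∷ 2 ∷ c ∷ suc c ∷ c + c ∷ []

  h g₂ : ℕ → ℕ
  h  = grd F
  g₂ = grdDesc (2 ∷ 1 ∷ [])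

  c>0 : 0 < c
  c>0 = <-trans z<s c>2

  c+c>0 : 0 < c + c
  c+c>0 = ≤-trans c>0 (m≤m+n c c)

  1+c≤c+c : suc c ≤ c + c
  1+c≤c+c = +-monoˡ-≤ c c>0

  x+[2+y]≡2+[x+y] : ∀ x y → x + (2 + y) ≡ 2 + (x + y)
  x+[2+y]≡2+[x+y] = solve-∀

  g₂-2+ : ∀ t → g₂ (2 + t) ≡ suc (g₂ t)
  g₂-2+ t = grdDesc-step (1 ∷ []) t z<s

  g₂-suc : ∀ t → g₂ (suc t) ≤ suc (g₂ t)
  g₂-suc zero          = s≤s z≤n
  g₂-suc (suc zero)    = s≤s z≤n
  g₂-suc (suc (suc t)) = subst₂ _≤_ (sym (g₂-2+ (suc t))) (cong suc (sym (g₂-2+ t))) (s≤s (g₂-suc t))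

  g₂-mono : ∀ t → g₂ t ≤ g₂ (suc t)
  g₂-mono zero          = z≤n
  g₂-mono (suc zero)    = s≤s z≤n
  g₂-mono (suc (suc t)) = subst₂ _≤_ (sym (g₂-2+ t)) (sym (g₂-2+ (suc t))) (s≤s (g₂-mono t))

  h-wrap : ∀ r → h (c + c + r) ≡ suc (h r)
  h-wrap r = grdDesc-step (suc c ∷ c ∷ 2 ∷ 1 ∷ []) r c+c>0

  h-below : ∀ {s} → s < c → h s ≡ g₂ s
  h-below s<c = grdDesc-skipAll (c + c ∷ suc c ∷ c ∷ []) (2 ∷ 1 ∷ [])
    (<-≤-trans s<c (≤-trans (n≤1+n c) 1+c≤c+c) ∷ <-trans s<c (n<1+n c) ∷ s<c ∷ [])

  h-c : h c ≡ 1
  h-c = trans (grdDesc-skipAll (c + c ∷ suc c ∷ []) (c ∷ 2 ∷ 1 ∷ [])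
                                (<-≤-trans (n<1+n c) 1+c≤c+c ∷ n<1+n c ∷ []))
              (trans (cong (grdDesc (c ∷ 2 ∷ 1 ∷ [])) (sym (+-identityʳ c))) (grdDesc-take (2 ∷ 1 ∷ []) c>0))

  h-above : ∀ {t} → suc c + t < c + c → h (suc c + t) ≡ suc (g₂ t)
  h-above {t} 1+c+t<c+c = trans (grdDesc-skip _ 1+c+t<c+c)
    (trans (grdDesc-take (c ∷ 2 ∷ 1 ∷ []) (<-trans t<c (n<1+n c)))
           (cong suc (grdDesc-skip (2 ∷ 1 ∷ []) t<c)))
    where
    t<c : t < c
    t<c = +-cancelˡ-< c t c (<-trans (n<1+n (c + t)) 1+c+t<c+c)

  h-0 : h 0 ≡ 0
  h-0 = grdDesc-zero (reverse F)

  h-1 : h 1 ≡ 1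
  h-1 = h-below (<-trans (s≤s z<s) c>2)

  h-c+c : h (c + c) ≡ 1
  h-c+c = trans (cong h (sym (+-identityʳ (c + c)))) (trans (h-wrap 0) (cong suc h-0))

  h>0 : ∀ {s} → 0 < s → 0 < h s
  h>0 {s} s>0 with h s in h≡
  ... | zero  = ⊥-elim (<-irrefl (sym (grdDesc≡0 (c + c ∷ suc c ∷ c ∷ 2 ∷ []) s h≡)) s>0)
  ... | suc _ = z<s

  one≤suc : ∀ {v} k → h v ≡ 1 → h v ≤ suc k
  one≤suc k h≡1 = ≤-trans (≤-reflexive h≡1) (s≤s z≤n)

  data Band (s : ℕ) : Set where
    below : s < c → Band s
    at-c  : s ≡ c → Band s
    above : ∀ t → s ≡ suc c + t → suc c + t < c + c → Band s

  band : ∀ s → s < c + c → Band s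
  band s s<c+c with <-cmp s c
  ... | tri< s<c _ _ = below s<c
  ... | tri≈ _ s≡c _ = at-c s≡c
  ... | tri> _ _ s>c with m≤n⇒∃[o]m+o≡n s>c
  ...   | t , 1+c+t≡s = above t (sym 1+c+t≡s) (subst (_< c + c) (sym 1+c+t≡s) s<c+c)

  -- Since h (2c + s) = 1 + h s, it suffices to check one coin step on values below 2c.
  periodic : ∀ y → (∀ s → s < c + c → h (y + s) ≤ suc (h s)) → ∀ s → h (y + s) ≤ suc (h s)
  periodic y base = <-rec _ step
    where
    step : ∀ s → (∀ {z} → z < s → h (y + z) ≤ suc (h z)) → h (y + s) ≤ suc (h s)
    step s ih with s <? c + c
    ... | yes s<c+c = base s s<c+c
    ... | no  s≮c+c with m≤n⇒∃[o]m+o≡n (≮⇒≥ s≮c+c)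
    ... | r , refl = begin
      h (y + (c + c + r))    ≡⟨ cong h (x+[y+z]≡y+[x+z] y (c + c) r) ⟩
      h (c + c + (y + r))    ≡⟨ h-wrap (y + r) ⟩
      suc (h (y + r))        ≤⟨ s≤s (ih (m<n+m r c+c>0)) ⟩
      suc (suc (h r))        ≡⟨ cong suc (h-wrap r) ⟨
      suc (h (c + c + r))    ∎
      where
      open ≤-Reasoning
      x+[y+z]≡y+[x+z] : ∀ x y z → x + (y + z) ≡ y + (x + z)
      x+[y+z]≡y+[x+z] = solve-∀

  step-1 : ∀ s → Band s → h (1 + s) ≤ suc (h s)
  step-1 s (below s<c) with suc s <? c
  ... | yes 1+s<c = subst₂ _≤_ (sym (h-below 1+s<c)) (cong suc (sym (h-below s<c))) (g₂-suc s)
  ... | no  1+s≮c = one≤suc _ (trans (cong h (≤-antisym s<c (≮⇒≥ 1+s≮c))) h-c)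
  step-1 _ (at-c refl) = one≤suc _ (trans (cong h (sym (+-identityʳ (suc c))))
    (h-above (subst (_< c + c) (sym (+-identityʳ (suc c))) (+-monoˡ-≤ c (<⇒≤ c>2)))))
  step-1 _ (above t refl 1+c+t<c+c) with suc c + suc t <? c + c
  ... | yes q = subst₂ _≤_ (sym (trans (cong h (sym (+-suc (suc c) t))) (h-above q)))
                           (cong suc (sym (h-above 1+c+t<c+c))) (s≤s (g₂-suc t))
  ... | no  q =
    one≤suc _ (trans (cong h (≤-antisym 1+c+t<c+c (subst (c + c ≤_) (+-suc (suc c) t) (≮⇒≥ q)))) h-c+c)

  step-2 : ∀ s → s < c + c → h (2 + s) ≤ suc (h s)
  step-2 s s<c+c with 2 + s <? c + c
  ... | yes 2+s<c+c = inside (band (2 + s) 2+s<c+c)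
    where
    inside : Band (2 + s) → h (2 + s) ≤ suc (h s)
    inside (below 2+s<c) = ≤-reflexive (trans (h-below 2+s<c)
      (trans (g₂-2+ s) (cong suc (sym (h-below (<-trans (m<n+m s z<s) 2+s<c))))))
    inside (at-c 2+s≡c) = one≤suc _ (trans (cong h 2+s≡c) h-c)
    inside (above t 2+s≡1+c+t p) =
      subst (_≤ suc (h s)) (sym (trans (cong h 2+s≡1+c+t) (h-above p))) (s≤s (g₂≤h t 2+s≡1+c+t))
      where
      g₂≤h : ∀ t → 2 + s ≡ suc c + t → g₂ t ≤ h s
      g₂≤h zero           _ = z≤n
      g₂≤h (suc zero)     e = ≤-reflexive (sym (trans (cong h s≡c) h-c))
        where
        s≡c : s ≡ c
        s≡c = +-cancelˡ-≡ 2 s c (trans e (+-comm (suc c) 1))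
      g₂≤h (suc (suc t′)) e =
        ≤-reflexive (trans (g₂-2+ t′) (sym (trans (cong h s≡) (h-above (subst (_< c + c) s≡ s<c+c)))))
        where
        s≡ : s ≡ suc c + t′
        s≡ = +-cancelˡ-≡ 2 s (suc c + t′) (trans e (x+[2+y]≡2+[x+y] (suc c) t′))
  ... | no  2+s≮c+c with m≤n⇒∃[o]m+o≡n (≮⇒≥ 2+s≮c+c)
  ...   | z , c+c+z≡2+s = begin
    h (2 + s)        ≡⟨ cong h (sym c+c+z≡2+s) ⟩
    h (c + c + z)    ≡⟨ h-wrap z ⟩
    suc (h z)        ≤⟨ s≤s (h≤1 z z≤1) ⟩
    2                ≤⟨ s≤s (h>0 s>0) ⟩
    suc (h s)        ∎
    where
    open ≤-Reasoning
    h≤1 : ∀ z → z ≤ 1 → h z ≤ 1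
    h≤1 zero          _ = ≤-trans (≤-reflexive h-0) z≤n
    h≤1 (suc zero)    _ = ≤-reflexive h-1
    h≤1 (suc (suc _)) (s≤s ())
    facts : List (Hyp (c ∷ s ∷ z ∷ []))
    facts = eq (var 0 ⊕ var 0 ⊕ var 2) (con 2 ⊕ var 1) c+c+z≡2+s ∷ lt (var 1) (var 0 ⊕ var 0) s<c+c
          ∷ lt (con 2) (var 0) c>2 ∷ []
    z≤1 : z ≤ 1
    z≤1 = linarith-≤ (var 2) (con 1) facts
    s>0 : 0 < s
    s>0 = linarith-≤ (con 1) (var 1) facts

  step-c : ∀ s → Band s → h (c + s) ≤ suc (h s)
  step-c zero    (below _)     = one≤suc _ (trans (cong h (+-identityʳ c)) h-c)
  step-c (suc t) (below 1+t<c) = begin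
    h (c + suc t)        ≡⟨ cong h (+-suc c t) ⟩
    h (suc c + t)        ≡⟨ h-above (subst (_< c + c) (+-suc c t) (+-monoʳ-< c 1+t<c)) ⟩
    suc (g₂ t)           ≤⟨ s≤s (g₂-mono t) ⟩
    suc (g₂ (suc t))     ≡⟨ cong suc (h-below 1+t<c) ⟨
    suc (h (suc t))      ∎
    where open ≤-Reasoning
  step-c _ (at-c refl) = one≤suc _ h-c+c
  step-c _ (above t refl 1+c+t<c+c) = begin
    h (c + (suc c + t))  ≡⟨ cong h (x+[1+x+y]≡x+x+[1+y] c t) ⟩
    h (c + c + suc t)    ≡⟨ h-wrap (suc t) ⟩
    suc (h (suc t))      ≡⟨ cong suc (h-below 1+t<c) ⟩
    suc (g₂ (suc t))     ≤⟨ s≤s (g₂-suc t) ⟩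
    suc (suc (g₂ t))     ≡⟨ cong suc (h-above 1+c+t<c+c) ⟨
    suc (h (suc c + t))  ∎
    where
    open ≤-Reasoning
    x+[1+x+y]≡x+x+[1+y] : ∀ x y → x + (suc x + y) ≡ x + x + suc y
    x+[1+x+y]≡x+x+[1+y] = solve-∀
    1+t<c : suc t < c
    1+t<c = +-cancelˡ-< c (suc t) c (subst (_< c + c) (sym (+-suc c t)) 1+c+t<c+c)

  step-1+c : ∀ s → Band s → h (suc c + s) ≤ suc (h s)
  step-1+c s (below s<c) with suc c + s <? c + c
  ... | yes 1+c+s<c+c = ≤-reflexive (trans (h-above 1+c+s<c+c) (cong suc (sym (h-below s<c))))
  ... | no  1+c+s≮c+c = one≤suc _ (trans (cong h (≤-antisym (+-monoʳ-< c s<c) (≮⇒≥ 1+c+s≮c+c))) h-c+c)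
  step-1+c _ (at-c refl) = ≤-reflexive (begin
    h (suc c + c)        ≡⟨ cong h (1+x+x≡x+x+1 c) ⟩
    h (c + c + 1)        ≡⟨ h-wrap 1 ⟩
    suc (h 1)            ≡⟨ cong suc (trans h-1 (sym h-c)) ⟩
    suc (h c)            ∎)
    where
    open ≡-Reasoning
    1+x+x≡x+x+1 : ∀ x → suc x + x ≡ x + x + 1
    1+x+x≡x+x+1 = solve-∀
  step-1+c _ (above t refl 1+c+t<c+c) = begin
    h (suc c + (suc c + t))   ≡⟨ cong h (1+x+[1+x+y]≡x+x+[2+y] c t) ⟩
    h (c + c + (2 + t))       ≡⟨ h-wrap (2 + t) ⟩
    suc (h (2 + t))           ≤⟨ s≤s (h-2+t≤) ⟩
    suc (suc (g₂ t))          ≡⟨ cong suc (h-above 1+c+t<c+c) ⟨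
    suc (h (suc c + t))       ∎
    where
    open ≤-Reasoning
    1+x+[1+x+y]≡x+x+[2+y] : ∀ x y → suc x + (suc x + y) ≡ x + x + (2 + y)
    1+x+[1+x+y]≡x+x+[2+y] = solve-∀
    h-2+t≤ : h (2 + t) ≤ suc (g₂ t)
    h-2+t≤ with 2 + t <? c
    ... | yes 2+t<c = ≤-reflexive (trans (h-below 2+t<c) (g₂-2+ t))
    ... | no  2+t≮c = one≤suc _ (trans (cong h 2+t≡c) h-c)
      where
      2+t≡c : 2 + t ≡ c
      2+t≡c = ≤-antisym (+-cancelˡ-≤ c (2 + t) c (subst (_≤ c + c) (sym (x+[2+y]≡2+[x+y] c t)) 1+c+t<c+c))
                        (≮⇒≥ 2+t≮c)

  steps : ∀ {y} → y ∈ F → ∀ s → h (y + s) ≤ suc (h s)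
  steps (here refl)                                 = periodic 1 (λ s s<c+c → step-1 s (band s s<c+c))
  steps (there (here refl))                         = periodic 2 step-2
  steps (there (there (here refl)))                 = periodic c (λ s s<c+c → step-c s (band s s<c+c))
  steps (there (there (there (here refl))))         = periodic (suc c) (λ s s<c+c → step-1+c s (band s s<c+c))
  steps (there (there (there (there (here refl))))) = λ s → ≤-reflexive (h-wrap s)

  orderly : Orderly F
  orderly = greedyOptimal⇒orderly (2 ∷ c ∷ suc c ∷ c + c ∷ []) (greedyOptimal-by-steps F steps)

F-orderly : ∀ {a c b d} → 2 < c → a ≡ 2 → b ≡ suc c → d ≡ c + c → Orderly (1 ∷ a ∷ c ∷ b ∷ d ∷ [])
F-orderly c>2 refl refl refl = FSystem.orderly _ c>2

-- Systems with pattern + + + − − +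

∈-below : ∀ xs {u ys z} → Linked _<_ (xs ++ u ∷ ys) → z ∈ xs ++ u ∷ ys → z < u → z ∈ xs
∈-below []       _              (here refl) z<u = ⊥-elim (<-irrefl refl z<u)
∈-below []       [-]            (there ())
∈-below []       (u<y ∷ sorted) (there z∈)  z<u =
  ⊥-elim (<-asym z<u (All.lookup (Linked⇒All <-trans u<y sorted) z∈))
∈-below (x ∷ xs) _              (here refl) _   = here refl
∈-below (x ∷ xs) sorted         (there z∈)  z<u = there (∈-below xs (Linked.tail sorted) z∈ z<u)

roundUp : ∀ n {k} → 0 < k → Σ ℕ λ m → Σ ℕ λ δ → n + δ ≡ m * k × δ < k
roundUp zero    {suc k} _   = 0 , 0 , refl , z<s
roundUp (suc n) {suc k} k>0 with roundUp n k>0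
... | m , zero  , n+0≡m*k , _   =
  suc m , k , cong suc (trans (+-comm n k) (cong (k +_) (trans (sym (+-identityʳ n)) n+0≡m*k))) , ≤-refl
... | m , suc δ , n+δ≡m*k , δ<k = m , δ , trans (sym (+-suc n δ)) n+δ≡m*k , <-trans (n<1+n δ) δ<k

Shape : List ℕ → Set
Shape C = (Σ ℕ λ a → Σ ℕ λ b → 3 ≤ a × 2 * a ∸ 1 < b
            × C ≡ (1 ∷ a ∷ 2 * a ∸ 1 ∷ b ∷ a + b ∸ 1 ∷ 2 * b ∸ 1 ∷ []))
        ⊎ (Σ ℕ λ a → Σ ℕ λ b → 2 ≤ a × 2 * a < b
            × C ≡ (1 ∷ a ∷ 2 * a ∷ b ∷ a + b ∷ 2 * b ∷ []))

module Classification (a c b d e : ℕ) (a≥2 : 2 ≤ a) (a<c : a < c) (c<b : c < b) (b<d : b < d) (d<e : d < e)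
  (optimal : GreedyOptimal (1 ∷ a ∷ c ∷ b ∷ d ∷ e ∷ []))
  (one-point-fails : ∀ {k x} → b + x ≡ k * c → k ≤ grd (1 ∷ a ∷ c ∷ []) x)
  (not-F : a ≡ 2 → b ≡ suc c → d ≡ c + c → ⊥)
  (m δ : ℕ) (b+δ≡m*c : b + δ ≡ m * c) (δ<c : δ < c) where

  C₆ : List ℕ
  C₆ = 1 ∷ a ∷ c ∷ b ∷ d ∷ e ∷ []

  G₃ G₆ : ℕ → ℕ
  G₃ = grd (1 ∷ a ∷ c ∷ [])
  G₆ = grd C₆

  sorted : Linked _<_ C₆
  sorted = a≥2 ∷ a<c ∷ c<b ∷ b<d ∷ d<e ∷ [-]

  -- Cases of r ≡ 0 ⊎ r ∈ 1 ∷ a ∷ c ∷ b ∷ d ∷ …; matching substitutes the coin for r.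
  pattern is0 = inj₁ refl
  pattern is1 = inj₂ (here refl)
  pattern isa = inj₂ (there (here refl))
  pattern isc = inj₂ (there (there (here refl)))
  pattern isb = inj₂ (there (there (there (here refl))))
  pattern isd = inj₂ (there (there (there (there (here refl)))))

  a∈ : a ∈ C₆
  a∈ = there (here refl)
  c∈ : c ∈ C₆
  c∈ = there (there (here refl))
  b∈ : b ∈ C₆
  b∈ = there (there (there (here refl)))
  d∈ : d ∈ C₆
  d∈ = there (there (there (there (here refl))))

  multiple≥2 : ∀ {k x} → b + x ≡ k * c → 2 ≤ k
  multiple≥2 {k} {x} b+x≡k*c with k ≤? 1
  ... | no  k≰1 = ≰⇒> k≰1
  ... | yes k≤1 = ⊥-elim (<-irrefl refl (begin-strict
    c + 0    ≡⟨ +-identityʳ c ⟩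
    c        <⟨ c<b ⟩
    b        ≤⟨ m≤m+n b x ⟩
    b + x    ≡⟨ b+x≡k*c ⟩
    k * c    ≤⟨ *-monoˡ-≤ c k≤1 ⟩
    c + 0    ∎))
    where open ≤-Reasoning

  G₃-small : ∀ {x} → x ≡ 0 ⊎ x ∈ 1 ∷ a ∷ [] → G₃ x ≤ 1
  G₃-small is0 = subst (_≤ 1) (sym (grdDesc-zero (c ∷ a ∷ 1 ∷ []))) z≤n
  G₃-small is1 = ≤-reflexive (trans (grdDesc-skip (a ∷ 1 ∷ []) (<-trans a≥2 a<c))
                               (grdDesc-skip (1 ∷ []) a≥2))
  G₃-small isa = ≤-reflexive (trans (grdDesc-skip (a ∷ 1 ∷ []) a<c)
                   (trans (cong (grdDesc (a ∷ 1 ∷ [])) (sym (+-identityʳ a)))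
                          (grdDesc-take (1 ∷ []) (<-trans z<s a≥2))))

  -- Greedy pays such an x with at most one coin, while one-point-fails demands k ≥ 2 of them.
  no-cheap-multiple : ∀ k {x} → b + x ≡ k * c → x ≡ 0 ⊎ x ∈ 1 ∷ a ∷ [] → ⊥
  no-cheap-multiple k b+x≡k*c x-small =
    ≤⇒≯ (≤-trans (one-point-fails {k} b+x≡k*c) (G₃-small x-small)) (multiple≥2 {k} b+x≡k*c)

  -- Below d, greedy pays m c = b + δ as b plus its change for δ, which is more than the m coins c.
  d≤b+δ : d ≤ b + δ
  d≤b+δ with d ≤? b + δ
  ... | yes d≤ = d≤
  ... | no  d≰ = ⊥-elim (<-irrefl refl (begin-strict
    m                ≤⟨ one-point-fails {m} b+δ≡m*c ⟩
    G₃ δ             <⟨ ≤-refl ⟩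
    suc (G₃ δ)       ≡⟨ greedy-b+δ ⟨
    G₆ (b + δ)       ≡⟨ cong G₆ b+δ≡m*c ⟩
    G₆ (m * c)       ≤⟨ c-coins ⟩
    m                ∎))
    where
    open ≤-Reasoning
    b+δ<d : b + δ < d
    b+δ<d = ≰⇒> d≰
    greedy-b+δ : G₆ (b + δ) ≡ suc (G₃ δ)
    greedy-b+δ = trans (grdDesc-skipAll (e ∷ d ∷ []) (b ∷ c ∷ a ∷ 1 ∷ []) (<-trans b+δ<d d<e ∷ b+δ<d ∷ []))
                       (grdDesc-take (c ∷ a ∷ 1 ∷ []) (<-trans δ<c c<b))
    c-coins : G₆ (m * c) ≤ m
    c-coins = subst₂ (λ v k → G₆ v ≤ k) (sum-replicate m c) (length-replicate m)
                (optimal _ (replicate m c) (AllP.replicate⁺ m c∈ , refl))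

  -- m * c enters the linear arithmetic as the atom M.
  ρ : Env
  ρ = a ∷ c ∷ b ∷ d ∷ e ∷ δ ∷ m * c ∷ []

  A C B D E Δ M : Expr
  A = var 0
  C = var 1
  B = var 2
  D = var 3
  E = var 4
  Δ = var 5
  M = var 6

  basics : List (Hyp ρ)
  basics = le (con 2) A a≥2 ∷ lt A C a<c ∷ lt C B c<b ∷ lt B D b<d ∷ lt D E d<e
         ∷ lt Δ C δ<c ∷ le D (B ⊕ Δ) d≤b+δ ∷ eq (B ⊕ Δ) M b+δ≡m*c ∷ []

  absurd-by : (hs : List (Hyp ρ)) → {Refutable (hs ++ basics)} → ⊥
  absurd-by hs {t} = linarith (hs ++ basics) {t}

  ≤-by : (l r : Expr) (hs : List (Hyp ρ)) → {∀ p → Refutable (lt r l p ∷ hs ++ basics)} → ⟦ l ⟧ ρ ≤ ⟦ r ⟧ ρ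
  ≤-by l r hs {t} = ≮⇒≥ (λ p → linarith (lt r l p ∷ hs ++ basics) {t p})

  <-by : (l r : Expr) (hs : List (Hyp ρ)) → {∀ p → Refutable (le r l p ∷ hs ++ basics)} → ⟦ l ⟧ ρ < ⟦ r ⟧ ρ
  <-by l r hs {t} = ≰⇒> (λ p → linarith (le r l p ∷ hs ++ basics) {t p})

  ≡-by : (l r : Expr) (hs : List (Hyp ρ)) →
    {∀ p → Refutable (lt r l p ∷ hs ++ basics)} → {∀ p → Refutable (lt l r p ∷ hs ++ basics)} → ⟦ l ⟧ ρ ≡ ⟦ r ⟧ ρ
  ≡-by l r hs {t} {t′} = ≤-antisym (≤-by l r hs {t}) (≤-by r l hs {t′})

  coin≤e : ∀ {u} → u ∈ C₆ → u ≤ e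
  coin≤e (here refl)                                         = ≤-by (con 1) E []
  coin≤e (there (here refl))                                 = ≤-by A E []
  coin≤e (there (there (here refl)))                         = ≤-by C E []
  coin≤e (there (there (there (here refl))))                 = ≤-by B E []
  coin≤e (there (there (there (there (here refl)))))         = ≤-by D E []
  coin≤e (there (there (there (there (there (here refl)))))) = ≤-refl

  pair-cost : ∀ {x y} → x ∈ C₆ → y ∈ C₆ → G₆ (x + y) ≤ 2
  pair-cost {x} {y} x∈ y∈ =
    optimal (x + y) (x ∷ y ∷ []) ((x∈ ∷ y∈ ∷ []) , cong (x +_) (+-identityʳ y))

  -- Greedy pays a sum of two coins with at most two coins; after its first coin t the rest is 0 or a coin.
  remainder : ∀ {x y t r} → x ∈ C₆ → y ∈ C₆ → t + r ≡ x + y → G₆ (t + r) ≡ suc (G₆ r) → r ≡ 0 ⊎ r ∈ C₆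
  remainder {r = r} x∈ y∈ t+r≡x+y cost =
    grd≤1 (a ∷ c ∷ b ∷ d ∷ e ∷ []) r
      (≤-pred (subst (_≤ 2) (trans (cong G₆ (sym t+r≡x+y)) cost) (pair-cost x∈ y∈)))

  below : ∀ ys {u zs r} → ys ++ u ∷ zs ≡ C₆ → r ≡ 0 ⊎ r ∈ C₆ → r < u → r ≡ 0 ⊎ r ∈ ys
  below ys split is0       _   = is0
  below ys split (inj₂ r∈) r<u =
    inj₂ (∈-below ys (subst (Linked _<_) (sym split) sorted) (subst (_ ∈_) (sym split) r∈) r<u)

  over-e : ∀ ys {u zs x y} → ys ++ u ∷ zs ≡ C₆ → x ∈ C₆ → y ∈ C₆ → e ≤ x + y → x + y < e + u →
    Σ ℕ λ r → e + r ≡ x + y × (r ≡ 0 ⊎ r ∈ ys)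
  over-e ys {u} split x∈ y∈ e≤x+y x+y<e+u with m≤n⇒∃[o]m+o≡n e≤x+y
  ... | r , e+r≡x+y = r , e+r≡x+y , below ys split (remainder x∈ y∈ e+r≡x+y cost) r<u
    where
    r<u : r < u
    r<u = +-cancelˡ-< e r u (subst (_< e + u) (sym e+r≡x+y) x+y<e+u)
    cost : G₆ (e + r) ≡ suc (G₆ r)
    cost = grdDesc-top [] (d ∷ b ∷ c ∷ a ∷ 1 ∷ []) []
             (<-≤-trans r<u (coin≤e (subst (u ∈_) split (AnyP.++⁺ʳ ys (here refl)))))

  over-d : ∀ {x y} → x ∈ C₆ → y ∈ C₆ → d ≤ x + y → x + y < e → x + y < d + b →
    Σ ℕ λ r → d + r ≡ x + y × (r ≡ 0 ⊎ r ∈ 1 ∷ a ∷ c ∷ [])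
  over-d x∈ y∈ d≤x+y x+y<e x+y<d+b with m≤n⇒∃[o]m+o≡n d≤x+y
  ... | r , d+r≡x+y = r , d+r≡x+y , below (1 ∷ a ∷ c ∷ []) refl (remainder x∈ y∈ d+r≡x+y cost) r<b
    where
    r<b : r < b
    r<b = +-cancelˡ-< d r b (subst (_< d + b) (sym d+r≡x+y) x+y<d+b)
    cost : G₆ (d + r) ≡ suc (G₆ r)
    cost = grdDesc-top (e ∷ []) (b ∷ c ∷ a ∷ 1 ∷ []) (subst (_< e) (sym d+r≡x+y) x+y<e ∷ [])
             (<-trans r<b b<d)

  c≢3 : c ≡ 3 → ⊥
  c≢3 c≡3 = no-cheap-multiple m b+δ≡m*c (small δ δ<c)
    where
    a≡2 : a ≡ 2
    a≡2 = ≡-by A (con 2) (eq C (con 3) c≡3 ∷ [])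
    small : ∀ x → x < c → x ≡ 0 ⊎ x ∈ 1 ∷ a ∷ []
    small 0 _ = is0
    small 1 _ = is1
    small 2 _ = inj₂ (there (here (sym a≡2)))
    small (suc (suc (suc x))) x<c = ⊥-elim (<⇒≱ (subst (3 + x <_) c≡3 x<c) (m≤m+n 3 x))

  coins≡ : ∀ {c′ d′ e′} → c ≡ c′ → d ≡ d′ → e ≡ e′ → C₆ ≡ 1 ∷ a ∷ c′ ∷ b ∷ d′ ∷ e′ ∷ []
  coins≡ refl refl refl = refl

  shape₁ : 3 ≤ a → c + 1 ≡ 2 * a → d + 1 ≡ a + b → e + 1 ≡ 2 * b → Shape C₆
  shape₁ a≥3 c+1≡2a d+1≡a+b e+1≡2b =
    inj₁ (a , b , a≥3 , subst (_< b) (minus-one c+1≡2a) c<b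
         , coins≡ (minus-one c+1≡2a) (minus-one d+1≡a+b) (minus-one e+1≡2b))
    where
    minus-one : ∀ {x y} → x + 1 ≡ y → x ≡ y ∸ 1
    minus-one {x} refl = sym (m+n∸n≡m x 1)

  shape₂ : c ≡ 2 * a → d ≡ a + b → e ≡ 2 * b → Shape C₆
  shape₂ c≡2a d≡a+b e≡2b = inj₂ (a , b , a≥2 , subst (_< b) c≡2a c<b , coins≡ c≡2a d≡a+b e≡2b)

  multiple-cases : m * c ≡ c + c ⊎ c + c + c ≤ m * c
  multiple-cases = cases m (multiple≥2 {m} b+δ≡m*c)
    where
    cases : ∀ k → 2 ≤ k → k * c ≡ c + c ⊎ c + c + c ≤ k * c
    cases (suc zero)          (s≤s ())
    cases (suc (suc zero))    _ = inj₁ (cong (c +_) (+-identityʳ c))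
    cases (suc (suc (suc k))) _ = inj₂ (subst (_≤ c + (c + (c + k * c))) (sym (+-assoc c c c))
                                               (+-monoʳ-≤ c (+-monoʳ-≤ c (m≤m+n c (k * c)))))

  module E≤B+C (e≤b+c : e ≤ b + c) where

    known : List (Hyp ρ)
    known = le E (B ⊕ C) e≤b+c ∷ []

    b≡c+1-impossible : e + 0 ≡ b + c → e + 1 ≡ b + b → ⊥
    b≡c+1-impossible e≡b+c e+1≡2b =
      case over-e (1 ∷ a ∷ c ∷ []) refl b∈ d∈ (≤-by E (B ⊕ D) hs) (<-by (B ⊕ D) (E ⊕ B) hs) of λ where
        (_ , h , is0) → absurd-by (eq (E ⊕ con 0) (B ⊕ D) h ∷ hs)
        (_ , h , is1) → absurd-by (eq (E ⊕ con 1) (B ⊕ D) h ∷ hs)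
        (_ , h , isa) → let hs′ = eq (E ⊕ A) (B ⊕ D) h ∷ hs in
          case over-e (1 ∷ []) refl c∈ d∈ (≤-by E (C ⊕ D) hs′) (<-by (C ⊕ D) (E ⊕ A) hs′) of λ where
            (_ , h′ , is0) → absurd-by (eq (E ⊕ con 0) (C ⊕ D) h′ ∷ hs′)
            (_ , h′ , is1) → let hs″ = eq (E ⊕ con 1) (C ⊕ D) h′ ∷ hs′ in
              case over-e (1 ∷ a ∷ c ∷ []) refl d∈ d∈ (≤-by E (D ⊕ D) hs″) (<-by (D ⊕ D) (E ⊕ B) hs″) of λ where
                (_ , h″ , is0) → absurd-by (eq (E ⊕ con 0) (D ⊕ D) h″ ∷ hs″)
                (_ , h″ , is1) → absurd-by (eq (E ⊕ con 1) (D ⊕ D) h″ ∷ hs″)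
                (_ , h″ , isa) → absurd-by (eq (E ⊕ A) (D ⊕ D) h″ ∷ hs″)
                (_ , h″ , isc) → c≢3 (≡-by C (con 3) (eq (E ⊕ C) (D ⊕ D) h″ ∷ hs″))
        (_ , h , isc) → let hs′ = eq (E ⊕ C) (B ⊕ D) h ∷ hs in
          case over-e (1 ∷ []) refl a∈ d∈ (≤-by E (A ⊕ D) hs′) (<-by (A ⊕ D) (E ⊕ A) hs′) of λ where
            (_ , h′ , is0) → absurd-by (eq (E ⊕ con 0) (A ⊕ D) h′ ∷ hs′)
            (_ , h′ , is1) → let hs″ = eq (E ⊕ con 1) (A ⊕ D) h′ ∷ hs′ in
              not-F (≡-by A (con 2) hs″) (≡-by B (con 1 ⊕ C) hs″) (≡-by D (C ⊕ C) hs″)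
      where
      hs = eq (E ⊕ con 0) (B ⊕ C) e≡b+c ∷ eq (E ⊕ con 1) (B ⊕ B) e+1≡2b ∷ known

    b≡c+a-impossible : e + 0 ≡ b + c → e + a ≡ b + b → ⊥
    b≡c+a-impossible e≡b+c e+a≡2b =
      case over-e (1 ∷ a ∷ c ∷ []) refl b∈ d∈ (≤-by E (B ⊕ D) hs) (<-by (B ⊕ D) (E ⊕ B) hs) of λ where
        (_ , h , is0) → absurd-by (eq (E ⊕ con 0) (B ⊕ D) h ∷ hs)
        (_ , h , is1) → absurd-by (eq (E ⊕ con 1) (B ⊕ D) h ∷ hs)
        (_ , h , isa) → absurd-by (eq (E ⊕ A) (B ⊕ D) h ∷ hs)
        (_ , h , isc) → let hs′ = eq (E ⊕ C) (B ⊕ D) h ∷ hs in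
          case over-e (1 ∷ a ∷ c ∷ b ∷ d ∷ []) refl d∈ d∈ (≤-by E (D ⊕ D) hs′) (<-by (D ⊕ D) (E ⊕ E) hs′) of λ where
            (_ , h′ , is0) → absurd-by (eq (E ⊕ con 0) (D ⊕ D) h′ ∷ hs′)
            (_ , h′ , is1) → absurd-by (eq (E ⊕ con 1) (D ⊕ D) h′ ∷ hs′)
            (_ , h′ , isa) → absurd-by (eq (E ⊕ A) (D ⊕ D) h′ ∷ hs′)
            (_ , h′ , isc) → absurd-by (eq (E ⊕ C) (D ⊕ D) h′ ∷ hs′)
            (_ , h′ , isb) → no-cheap-multiple 2 (≡-by (B ⊕ A) (2 ⊛ C) (eq (E ⊕ B) (D ⊕ D) h′ ∷ hs′)) isa
            (_ , h′ , isd) → absurd-by (eq (E ⊕ D) (D ⊕ D) h′ ∷ hs′)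
      where
      hs = eq (E ⊕ con 0) (B ⊕ C) e≡b+c ∷ eq (E ⊕ A) (B ⊕ B) e+a≡2b ∷ known

    e≡b+c-impossible : e + 0 ≡ b + c → ⊥
    e≡b+c-impossible e≡b+c =
      case over-e (1 ∷ a ∷ c ∷ []) refl b∈ b∈ (≤-by E (B ⊕ B) hs) (<-by (B ⊕ B) (E ⊕ B) hs) of λ where
        (_ , h , is0) → absurd-by (eq (E ⊕ con 0) (B ⊕ B) h ∷ hs)
        (_ , h , is1) → b≡c+1-impossible e≡b+c h
        (_ , h , isa) → b≡c+a-impossible e≡b+c h
        (_ , h , isc) → no-cheap-multiple 2 (≡-by (B ⊕ con 0) (2 ⊛ C) (eq (E ⊕ C) (B ⊕ B) h ∷ hs)) is0
      where
      hs = eq (E ⊕ con 0) (B ⊕ C) e≡b+c ∷ known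

    e+1≡b+c-impossible : e + 1 ≡ b + c → ⊥
    e+1≡b+c-impossible e+1≡b+c =
      case over-e (1 ∷ a ∷ c ∷ []) refl b∈ b∈ (≤-by E (B ⊕ B) hs) (<-by (B ⊕ B) (E ⊕ B) hs) of λ where
        (_ , h , is0) → absurd-by (eq (E ⊕ con 0) (B ⊕ B) h ∷ hs)
        (_ , h , is1) → absurd-by (eq (E ⊕ con 1) (B ⊕ B) h ∷ hs)
        (_ , h , isc) → no-cheap-multiple 2 (≡-by (B ⊕ con 1) (2 ⊛ C) (eq (E ⊕ C) (B ⊕ B) h ∷ hs)) is1
        (_ , h , isa) → let hs′ = eq (E ⊕ A) (B ⊕ B) h ∷ hs in
          case over-e (1 ∷ a ∷ c ∷ []) refl b∈ d∈ (≤-by E (B ⊕ D) hs′) (<-by (B ⊕ D) (E ⊕ B) hs′) of λ where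
            (_ , h′ , is0) → absurd-by (eq (E ⊕ con 0) (B ⊕ D) h′ ∷ hs′)
            (_ , h′ , is1) → absurd-by (eq (E ⊕ con 1) (B ⊕ D) h′ ∷ hs′)
            (_ , h′ , isa) → absurd-by (eq (E ⊕ A) (B ⊕ D) h′ ∷ hs′)
            (_ , h′ , isc) → let hs″ = eq (E ⊕ C) (B ⊕ D) h′ ∷ hs′ in
              case over-e (1 ∷ a ∷ c ∷ b ∷ d ∷ []) refl d∈ d∈ (≤-by E (D ⊕ D) hs″) (<-by (D ⊕ D) (E ⊕ E) hs″) of λ where
                (_ , h″ , is0) → absurd-by (eq (E ⊕ con 0) (D ⊕ D) h″ ∷ hs″)
                (_ , h″ , is1) → absurd-by (eq (E ⊕ con 1) (D ⊕ D) h″ ∷ hs″)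
                (_ , h″ , isa) → absurd-by (eq (E ⊕ A) (D ⊕ D) h″ ∷ hs″)
                (_ , h″ , isc) → absurd-by (eq (E ⊕ C) (D ⊕ D) h″ ∷ hs″)
                (_ , h″ , isb) → no-cheap-multiple 2 (≡-by (B ⊕ A) (2 ⊛ C) (eq (E ⊕ B) (D ⊕ D) h″ ∷ hs″)) isa
                (_ , h″ , isd) → absurd-by (eq (E ⊕ D) (D ⊕ D) h″ ∷ hs″)
      where
      hs = eq (E ⊕ con 1) (B ⊕ C) e+1≡b+c ∷ known

    e+a≡b+c-impossible : e + a ≡ b + c → ⊥
    e+a≡b+c-impossible e+a≡b+c =
      case over-e (1 ∷ a ∷ c ∷ []) refl b∈ b∈ (≤-by E (B ⊕ B) hs) (<-by (B ⊕ B) (E ⊕ B) hs) of λ where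
        (_ , h , is0) → absurd-by (eq (E ⊕ con 0) (B ⊕ B) h ∷ hs)
        (_ , h , is1) → absurd-by (eq (E ⊕ con 1) (B ⊕ B) h ∷ hs)
        (_ , h , isa) → absurd-by (eq (E ⊕ A) (B ⊕ B) h ∷ hs)
        (_ , h , isc) → no-cheap-multiple 2 (≡-by (B ⊕ A) (2 ⊛ C) (eq (E ⊕ C) (B ⊕ B) h ∷ hs)) isa
      where
      hs = eq (E ⊕ A) (B ⊕ C) e+a≡b+c ∷ known

    impossible : ⊥
    impossible =
      case over-e (1 ∷ a ∷ []) refl b∈ c∈ e≤b+c (<-by (B ⊕ C) (E ⊕ C) known) of λ where
        (_ , h , is0) → e≡b+c-impossible h
        (_ , h , is1) → e+1≡b+c-impossible h
        (_ , h , isa) → e+a≡b+c-impossible h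

  module B+C<E (b+c<e : b + c < e) where

    module D+A≡B+C (d+a≡b+c : d + a ≡ b + c) where

      known : List (Hyp ρ)
      known = lt (B ⊕ C) E b+c<e ∷ eq (D ⊕ A) (B ⊕ C) d+a≡b+c ∷ []

      2b<e-impossible : b + b < e → ⊥
      2b<e-impossible 2b<e =
        case over-d b∈ b∈ (≤-by D (B ⊕ B) known) 2b<e (<-by (B ⊕ B) (D ⊕ B) known) of λ where
          (_ , h , is0) → absurd-by (eq (D ⊕ con 0) (B ⊕ B) h ∷ known)
          (_ , h , is1) → absurd-by (eq (D ⊕ con 1) (B ⊕ B) h ∷ known)
          (_ , h , isa) → absurd-by (eq (D ⊕ A) (B ⊕ B) h ∷ known)
          (_ , h , isc) → no-cheap-multiple 2 (≡-by (B ⊕ A) (2 ⊛ C) (eq (D ⊕ C) (B ⊕ B) h ∷ known)) isa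

      e≡2b : e + 0 ≡ b + b → Shape C₆
      e≡2b e≡2b =
        case over-e (1 ∷ a ∷ []) refl b∈ d∈ (≤-by E (B ⊕ D) hs) (<-by (B ⊕ D) (E ⊕ C) hs) of λ where
          (_ , h , is0) → ⊥-elim (absurd-by (eq (E ⊕ con 0) (B ⊕ D) h ∷ hs))
          (_ , h , isa) → let hs′ = eq (E ⊕ A) (B ⊕ D) h ∷ hs in
            shape₂ (≡-by C (2 ⊛ A) hs′) (≡-by D (A ⊕ B) hs′) (≡-by E (2 ⊛ B) hs′)
          (_ , h , is1) → let hs′ = eq (E ⊕ con 1) (B ⊕ D) h ∷ hs in
            case over-e (1 ∷ a ∷ []) refl d∈ d∈ (≤-by E (D ⊕ D) hs′) (<-by (D ⊕ D) (E ⊕ C) hs′) of λ where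
              (_ , h′ , is0) → ⊥-elim (absurd-by (eq (E ⊕ con 0) (D ⊕ D) h′ ∷ hs′))
              (_ , h′ , is1) → ⊥-elim (absurd-by (eq (E ⊕ con 1) (D ⊕ D) h′ ∷ hs′))
              (_ , h′ , isa) → ⊥-elim (c≢3 (≡-by C (con 3) (eq (E ⊕ A) (D ⊕ D) h′ ∷ hs′)))
        where
        hs = eq (E ⊕ con 0) (B ⊕ B) e≡2b ∷ known

      e+1≡2b : e + 1 ≡ b + b → Shape C₆
      e+1≡2b e+1≡2b =
        case over-e (1 ∷ a ∷ []) refl b∈ d∈ (≤-by E (B ⊕ D) hs) (<-by (B ⊕ D) (E ⊕ C) hs) of λ where
          (_ , h , is0) → ⊥-elim (absurd-by (eq (E ⊕ con 0) (B ⊕ D) h ∷ hs))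
          (_ , h , is1) → ⊥-elim (absurd-by (eq (E ⊕ con 1) (B ⊕ D) h ∷ hs))
          (_ , h , isa) → let hs′ = eq (E ⊕ A) (B ⊕ D) h ∷ hs in
            case 3 ≤? a of λ where
              (yes a≥3) → shape₁ a≥3 (≡-by (C ⊕ con 1) (2 ⊛ A) hs′) (≡-by (D ⊕ con 1) (A ⊕ B) hs′)
                                     (≡-by (E ⊕ con 1) (2 ⊛ B) hs′)
              (no  a≱3) → ⊥-elim (c≢3 (≡-by C (con 3) (lt A (con 3) (≰⇒> a≱3) ∷ hs′)))
        where
        hs = eq (E ⊕ con 1) (B ⊕ B) e+1≡2b ∷ known

      e+a≡2b-impossible : e + a ≡ b + b → ⊥
      e+a≡2b-impossible e+a≡2b =
        case over-e (1 ∷ a ∷ c ∷ b ∷ d ∷ []) refl d∈ d∈ (≤-by E (D ⊕ D) hs) (<-by (D ⊕ D) (E ⊕ E) hs) of λ where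
          (_ , h , is0) → absurd-by (eq (E ⊕ con 0) (D ⊕ D) h ∷ hs)
          (_ , h , is1) → absurd-by (eq (E ⊕ con 1) (D ⊕ D) h ∷ hs)
          (_ , h , isa) → absurd-by (eq (E ⊕ A) (D ⊕ D) h ∷ hs)
          (_ , h , isc) → absurd-by (eq (E ⊕ C) (D ⊕ D) h ∷ hs)
          (_ , h , isb) → no-cheap-multiple 2 (≡-by (B ⊕ A) (2 ⊛ C) (eq (E ⊕ B) (D ⊕ D) h ∷ hs)) isa
          (_ , h , isd) → absurd-by (eq (E ⊕ D) (D ⊕ D) h ∷ hs)
        where
        hs = eq (E ⊕ A) (B ⊕ B) e+a≡2b ∷ known

      e+c≡2b-impossible : e + c ≡ b + b → ⊥
      e+c≡2b-impossible e+c≡2b =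
        case over-e (1 ∷ a ∷ c ∷ []) refl b∈ d∈ (≤-by E (B ⊕ D) hs) (<-by (B ⊕ D) (E ⊕ B) hs) of λ where
          (_ , h , is0) → absurd-by (eq (E ⊕ con 0) (B ⊕ D) h ∷ hs)
          (_ , h , is1) → absurd-by (eq (E ⊕ con 1) (B ⊕ D) h ∷ hs)
          (_ , h , isa) → absurd-by (eq (E ⊕ A) (B ⊕ D) h ∷ hs)
          (_ , h , isc) → absurd-by (eq (E ⊕ C) (B ⊕ D) h ∷ hs)
        where
        hs = eq (E ⊕ C) (B ⊕ B) e+c≡2b ∷ known

      shape : Shape C₆
      shape with e ≤? b + b
      ... | no  e≰2b = ⊥-elim (2b<e-impossible (≰⇒> e≰2b))
      ... | yes e≤2b =
        case over-e (1 ∷ a ∷ c ∷ []) refl b∈ b∈ e≤2b (<-by (B ⊕ B) (E ⊕ B) known) of λ where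
          (_ , h , is0) → e≡2b h
          (_ , h , is1) → e+1≡2b h
          (_ , h , isa) → ⊥-elim (e+a≡2b-impossible h)
          (_ , h , isc) → ⊥-elim (e+c≡2b-impossible h)

    module D+1≡B+C (d+1≡b+c : d + 1 ≡ b + c) where

      known : List (Hyp ρ)
      known = lt (B ⊕ C) E b+c<e ∷ eq (D ⊕ con 1) (B ⊕ C) d+1≡b+c ∷ []

      -- Here d ≤ b + δ forces δ = c − 1, so that m c = b + c − 1.
      b+1≢a+c : b + 1 ≡ a + c → ⊥
      b+1≢a+c b+1≡a+c = case multiple-cases of λ where
          (inj₁ m*c≡2c)  → let hs′ = eq M (C ⊕ C) m*c≡2c ∷ hs in
            not-F (≡-by A (con 2) hs′) (≡-by B (con 1 ⊕ C) hs′) (≡-by D (C ⊕ C) hs′)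
          (inj₂ 3c≤m*c) → absurd-by (le (C ⊕ C ⊕ C) M 3c≤m*c ∷ hs)
        where
        hs = eq (B ⊕ con 1) (A ⊕ C) b+1≡a+c ∷ known

      2b<e-impossible : b + b < e → ⊥
      2b<e-impossible 2b<e =
        case over-d b∈ b∈ (≤-by D (B ⊕ B) known) 2b<e (<-by (B ⊕ B) (D ⊕ B) known) of λ where
          (_ , h , is0) → absurd-by (eq (D ⊕ con 0) (B ⊕ B) h ∷ known)
          (_ , h , is1) → absurd-by (eq (D ⊕ con 1) (B ⊕ B) h ∷ known)
          (_ , h , isa) → b+1≢a+c (≡-by (B ⊕ con 1) (A ⊕ C) (eq (D ⊕ A) (B ⊕ B) h ∷ known))
          (_ , h , isc) → no-cheap-multiple 2 (≡-by (B ⊕ con 1) (2 ⊛ C) (eq (D ⊕ C) (B ⊕ B) h ∷ known)) is1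

      e≡2b-impossible : e + 0 ≡ b + b → ⊥
      e≡2b-impossible e≡2b =
        case over-e (1 ∷ a ∷ []) refl b∈ d∈ (≤-by E (B ⊕ D) hs) (<-by (B ⊕ D) (E ⊕ C) hs) of λ where
          (_ , h , is0) → absurd-by (eq (E ⊕ con 0) (B ⊕ D) h ∷ hs)
          (_ , h , is1) → absurd-by (eq (E ⊕ con 1) (B ⊕ D) h ∷ hs)
          (_ , h , isa) → no-cheap-multiple m (≡-by (B ⊕ A) M (eq (E ⊕ A) (B ⊕ D) h ∷ hs)) isa
        where
        hs = eq (E ⊕ con 0) (B ⊕ B) e≡2b ∷ known

      e+1≡2b-impossible : e + 1 ≡ b + b → ⊥
      e+1≡2b-impossible e+1≡2b =
        case over-e (1 ∷ a ∷ c ∷ b ∷ d ∷ []) refl d∈ d∈ (≤-by E (D ⊕ D) hs) (<-by (D ⊕ D) (E ⊕ E) hs) of λ where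
          (_ , h , is0) → absurd-by (eq (E ⊕ con 0) (D ⊕ D) h ∷ hs)
          (_ , h , is1) → absurd-by (eq (E ⊕ con 1) (D ⊕ D) h ∷ hs)
          (_ , h , isa) → absurd-by (eq (E ⊕ A) (D ⊕ D) h ∷ hs)
          (_ , h , isc) → absurd-by (eq (E ⊕ C) (D ⊕ D) h ∷ hs)
          (_ , h , isb) → no-cheap-multiple 2 (≡-by (B ⊕ con 1) (2 ⊛ C) (eq (E ⊕ B) (D ⊕ D) h ∷ hs)) is1
          (_ , h , isd) → absurd-by (eq (E ⊕ D) (D ⊕ D) h ∷ hs)
        where
        hs = eq (E ⊕ con 1) (B ⊕ B) e+1≡2b ∷ known

      e+a≡2b-impossible : e + a ≡ b + b → ⊥
      e+a≡2b-impossible e+a≡2b =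
        case over-e (1 ∷ a ∷ c ∷ b ∷ []) refl b∈ d∈ (≤-by E (B ⊕ D) hs) (<-by (B ⊕ D) (E ⊕ D) hs) of λ where
          (_ , h , is0) → absurd-by (eq (E ⊕ con 0) (B ⊕ D) h ∷ hs)
          (_ , h , is1) → absurd-by (eq (E ⊕ con 1) (B ⊕ D) h ∷ hs)
          (_ , h , isa) → absurd-by (eq (E ⊕ A) (B ⊕ D) h ∷ hs)
          (_ , h , isc) → absurd-by (eq (E ⊕ C) (B ⊕ D) h ∷ hs)
          (_ , h , isb) → b+1≢a+c (≡-by (B ⊕ con 1) (A ⊕ C) (eq (E ⊕ B) (B ⊕ D) h ∷ hs))
        where
        hs = eq (E ⊕ A) (B ⊕ B) e+a≡2b ∷ known

      e+c≡2b-impossible : e + c ≡ b + b → ⊥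
      e+c≡2b-impossible e+c≡2b =
        case over-e (1 ∷ a ∷ c ∷ []) refl b∈ d∈ (≤-by E (B ⊕ D) hs) (<-by (B ⊕ D) (E ⊕ B) hs) of λ where
          (_ , h , is0) → absurd-by (eq (E ⊕ con 0) (B ⊕ D) h ∷ hs)
          (_ , h , is1) → absurd-by (eq (E ⊕ con 1) (B ⊕ D) h ∷ hs)
          (_ , h , isa) → absurd-by (eq (E ⊕ A) (B ⊕ D) h ∷ hs)
          (_ , h , isc) → absurd-by (eq (E ⊕ C) (B ⊕ D) h ∷ hs)
        where
        hs = eq (E ⊕ C) (B ⊕ B) e+c≡2b ∷ known

      impossible : ⊥
      impossible with e ≤? b + b
      ... | no  e≰2b = 2b<e-impossible (≰⇒> e≰2b)
      ... | yes e≤2b =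
        case over-e (1 ∷ a ∷ c ∷ []) refl b∈ b∈ e≤2b (<-by (B ⊕ B) (E ⊕ B) known) of λ where
          (_ , h , is0) → e≡2b-impossible h
          (_ , h , is1) → e+1≡2b-impossible h
          (_ , h , isa) → e+a≡2b-impossible h
          (_ , h , isc) → e+c≡2b-impossible h

    shape : Shape C₆
    shape =
      case over-d b∈ c∈ (≤-by D (B ⊕ C) []) b+c<e (<-by (B ⊕ C) (D ⊕ B) []) of λ where
        (_ , h , is0) → ⊥-elim (absurd-by (eq (D ⊕ con 0) (B ⊕ C) h ∷ []))
        (_ , h , is1) → ⊥-elim (D+1≡B+C.impossible h)
        (_ , h , isa) → D+A≡B+C.shape h
        (_ , h , isc) → ⊥-elim (absurd-by (eq (D ⊕ C) (B ⊕ C) h ∷ []))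

  shape : Shape C₆
  shape with e ≤? b + c
  ... | yes e≤b+c = ⊥-elim (E≤B+C.impossible e≤b+c)
  ... | no  e≰b+c = B+C<E.shape (≰⇒> e≰b+c)

lemma3p2 : (c₂ c₃ c₄ c₅ c₆ : ℕ)
    → CoinSystem (1 ∷ c₂ ∷ c₃ ∷ c₄ ∷ c₅ ∷ c₆ ∷ [])
    → HasPattern (1 ∷ c₂ ∷ c₃ ∷ c₄ ∷ c₅ ∷ c₆ ∷ []) (plus ∷ plus ∷ plus ∷ minus ∷ minus ∷ plus ∷ [])
    → (Σ ℕ λ a → Σ ℕ λ b → 3 ≤ a × 2 * a ∸ 1 < b
         × (1 ∷ c₂ ∷ c₃ ∷ c₄ ∷ c₅ ∷ c₆ ∷ []) ≡ (1 ∷ a ∷ 2 * a ∸ 1 ∷ b ∷ a + b ∸ 1 ∷ 2 * b ∸ 1 ∷ []))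
      ⊎ (Σ ℕ λ a → Σ ℕ λ b → 2 ≤ a × 2 * a < b
         × (1 ∷ c₂ ∷ c₃ ∷ c₄ ∷ c₅ ∷ c₆ ∷ []) ≡ (1 ∷ a ∷ 2 * a ∷ b ∷ a + b ∷ 2 * b ∷ []))
lemma3p2 a c b d e (refl , a≥2 ∷ a<c ∷ c<b ∷ b<d ∷ d<e ∷ [-]) (_ , signs) =
  let m , δ , b+δ≡m*c , δ<c = roundUp b c>0 in
  Classification.shape a c b d e a≥2 a<c c<b b<d d<e
    (orderly⇒greedyOptimal _ (signs (# 5))) one-point-fails not-F m δ b+δ≡m*c δ<c
  where
  c>0 : 0 < c
  c>0 = <-trans z<s (<-trans a≥2 a<c)
  one-point-fails : ∀ {k x} → b + x ≡ k * c → k ≤ grd (1 ∷ a ∷ c ∷ []) x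
  one-point-fails b+x≡k*c = ≮⇒≥ λ cheap → signs (# 3)
    (OnePoint.orderly (a ∷ c ∷ []) (a ∷ 1 ∷ []) refl c>0 (orderly⇒greedyOptimal _ (signs (# 2))) c<b b+x≡k*c cheap)
  not-F : a ≡ 2 → b ≡ suc c → d ≡ c + c → ⊥
  not-F a≡2 b≡1+c d≡c+c = signs (# 4) (F-orderly (≤-<-trans a≥2 a<c) a≡2 b≡1+c d≡c+c)
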